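{- Let $\mathsf P$ and $\mathsf Q$ be problems. Suppose there is a computable function $f$ such that for all $i,j\in\omega$, $\Phi_{f(i,j)}$ is (the characteristic function of) a computable $\mathsf P$-instance $X$ which witnesses that $\Phi_i,\Phi_j$ do not witness $\mathsf P\le_{\mathrm{sW}}\mathsf Q$ on $X$, i.e. either $\Phi_i^X$ is not a $\mathsf Q$-instance or there is a solution $\hat Y$ of $\Phi_i^X$ such that $\Phi_j^{\hat Y}$ is not a solution of $X$. Then $\mathsf P\not\le_W\mathsf Q$.
   Context: $(\Phi_e)_{e\in\omega}$ is a standard enumeration of Turing functionals (and of partial computable functions). A problem consists of a class of instances (subsets of $\omega$) and, for each instance, a class of solutions. $\mathsf P\le_{\mathrm{sW}}\mathsf Q$ means there are fixed Turing functionals $\Phi,\Psi$ such that for every $\mathsf P$-instance $X$, $\Phi^X$ is a $\mathsf Q$-instance and for every solution $\hat Y$ of $\Phi^X$, $\Psi^{\hat Y}$ is a solution of $X$. $\mathsf P\le_W\mathsf Q$ means the same except that the backward computation is $\Psi^{X\oplus\hat Y}$. -}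

module Defs where

open import Data.Nat using (ℕ; zero; suc; _+_; _*_; _<_)
open import Data.Nat.DivMod using (_/_; _%_)
open import Data.Bool using (Bool; true; false; if_then_else_)
open import Data.Product using (Σ; _×_; _,_; proj₁; proj₂)
open import Data.Sum using (_⊎_)
open import Relation.Binary.PropositionalEquality using (_≡_)
open import Relation.Nullary using (¬_)

Subset : Set
Subset = ℕ → Bool

∅ : Subset
∅ _ = false

-- X ⊕ Y  =  {2n : n ∈ X} ∪ {2n+1 : n ∈ Y}
_⊕_ : Subset → Subset → Subset
(X ⊕ Y) zero = X zero
(X ⊕ Y) (suc zero) = Y zero
(X ⊕ Y) (suc (suc n)) = ((λ k → X (suc k)) ⊕ (λ k → Y (suc k))) n

-- Cantor pairing  ⟨a,b⟩ = (a+b)(a+b+1)/2 + a  and its inverse.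

tri : ℕ → ℕ
tri zero = zero
tri (suc s) = tri s + suc s

pair : ℕ → ℕ → ℕ
pair a b = tri (a + b) + a

unpair : ℕ → ℕ × ℕ
unpair zero = 0 , 0
unpair (suc n) with unpair n
... | a , suc b = suc a , b
... | a , zero = 0 , suc a

-- Oracle partial recursive functions (unary, with pairing), the
-- model of computation underlying the enumeration (Φ_e).

data Code : Set where
  cZero cSucc cId cFst cSnd cOracle : Code
  cComp cPair cRec : Code → Code → Code
  cMin : Code → Code

-- Big-step semantics: Eval O c x y  means  c^O(x) ↓ = y.
mutual
  data Eval (O : Subset) : Code → ℕ → ℕ → Set where
    eZero   : ∀ {x} → Eval O cZero x 0
    eSucc   : ∀ {x} → Eval O cSucc x (suc x)
    eId     : ∀ {x} → Eval O cId x x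
    eFst    : ∀ {x} → Eval O cFst x (proj₁ (unpair x))
    eSnd    : ∀ {x} → Eval O cSnd x (proj₂ (unpair x))
    eOracle : ∀ {x} → Eval O cOracle x (if O x then 1 else 0)
    eComp   : ∀ {f g x y z} → Eval O g x y → Eval O f y z → Eval O (cComp f g) x z
    ePair   : ∀ {f g x y z} → Eval O f x y → Eval O g x z → Eval O (cPair f g) x (pair y z)
    -- rec f g ⟨x,0⟩ = f x ;  rec f g ⟨x,n+1⟩ = g ⟨x,⟨n, rec f g ⟨x,n⟩⟩⟩
    eRec    : ∀ {f g x y} → RecEval O f g (proj₁ (unpair x)) (proj₂ (unpair x)) y
            → Eval O (cRec f g) x y
    eMin    : ∀ {f x n} → Eval O f (pair x n) 0
            → (∀ m → m < n → Σ ℕ λ k → Eval O f (pair x m) (suc k))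
            → Eval O (cMin f) x n

  data RecEval (O : Subset) (f g : Code) (x : ℕ) : ℕ → ℕ → Set where
    rZero : ∀ {y} → Eval O f x y → RecEval O f g x 0 y
    rSuc  : ∀ {n r y} → RecEval O f g x n r → Eval O g (pair x (pair n r)) y
          → RecEval O f g x (suc n) y

-- Gödel numbering: a (surjective) decoding ℕ → Code.
-- 0 ↦ cZero ; k+1 ↦ constructor with tag k % 10, arguments unpair (k / 10)
-- (arguments have smaller index, so fuel = index suffices).

decodeFuel : ℕ → ℕ → Code
decodeFuel zero _ = cZero
decodeFuel (suc fuel) zero = cZero
decodeFuel (suc fuel) (suc k) = build (k % 10)
  where
  a = proj₁ (unpair (k / 10))
  b = proj₂ (unpair (k / 10))
  build : ℕ → Code
  build 0 = cZero
  build 1 = cSucc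
  build 2 = cId
  build 3 = cFst
  build 4 = cSnd
  build 5 = cOracle
  build 6 = cComp (decodeFuel fuel a) (decodeFuel fuel b)
  build 7 = cPair (decodeFuel fuel a) (decodeFuel fuel b)
  build 8 = cRec (decodeFuel fuel a) (decodeFuel fuel b)
  build _ = cMin (decodeFuel fuel a)

decode : ℕ → Code
decode e = decodeFuel e e

Φ[_]^_[_]≡_ : ℕ → Subset → ℕ → ℕ → Set
Φ[ e ]^ O [ x ]≡ y = Eval O (decode e) x y

Computes : ℕ → Subset → Subset → Set
Computes e O Z = ∀ n → Φ[ e ]^ O [ n ]≡ (if Z n then 1 else 0)

ComputableFun₂ : (ℕ → ℕ → ℕ) → Set
ComputableFun₂ f = Σ ℕ λ c → ∀ i j → Φ[ c ]^ ∅ [ pair i j ]≡ f i j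

-- Problems: instances and solutions are subsets of ω (extensional classes).

_≗_ : Subset → Subset → Set
X ≗ Y = ∀ n → X n ≡ Y n

record Problem : Set₁ where
  field
    Inst : Subset → Set
    Sol  : Subset → Subset → Set      -- Sol X Y : Y is a solution of X
    Inst-ext : ∀ {X X'} → X ≗ X' → Inst X → Inst X'
    Sol-ext  : ∀ {X X' Y Y'} → X ≗ X' → Y ≗ Y' → Sol X Y → Sol X' Y'
open Problem public

IsInstVia : Problem → ℕ → Subset → Set
IsInstVia P e O = Σ Subset λ Z → Computes e O Z × Inst P Z

IsSolVia : Problem → Subset → ℕ → Subset → Set
IsSolVia P X e O = Σ Subset λ W → Computes e O W × Sol P X W

_≤W_ : Problem → Problem → Set
P ≤W Q = Σ ℕ λ φ → Σ ℕ λ ψ → ∀ X → Inst P X →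
  Σ Subset λ Z → Computes φ X Z × Inst Q Z ×
    (∀ Ŷ → Sol Q Z Ŷ → IsSolVia P X ψ (X ⊕ Ŷ))

Defeats : Problem → Problem → ℕ → ℕ → Subset → Set
Defeats P Q i j X =
  (¬ IsInstVia Q i X) ⊎
  (Σ Subset λ Ŷ → Σ Subset λ Z → Computes i X Z × Sol Q Z Ŷ × ¬ IsSolVia P X j Ŷ)

{-# OPTIONS --safe #-}
module Submission where

-- Suppose Φ_φ, Φ_ψ witness P ≤W Q.  The recursion theorem gives an index j such that Φ_j^Y
-- computes Φ_ψ^(X ⊕ Y) for every Y, where X = Φ_{f(φ,j)}: the program j finds its own index,
-- computes f(φ,j), decides X by running that program through a universal code, and answers
-- the oracle queries of Φ_ψ from X and Y.  Then X cannot defeat (φ, j): Φ_φ^X is a Q-instance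
-- because the reduction applies to the P-instance X, and for each solution Ŷ of it the set
-- Φ_j^Ŷ = Φ_ψ^(X ⊕ Ŷ) solves X.
--
-- The universal code runs a stack machine on states coded by natural numbers.  Its single step
-- is total and oracle-free, and the code searches for the least number of steps after which the
-- machine has halted.

open import Data.Bool using (Bool; true; false; if_then_else_; T; _∧_)
open import Data.Bool.Properties using (T-∧)
open import Data.Empty using (⊥; ⊥-elim)
open import Data.List using (List; []; _∷_)
open import Data.List.Relation.Binary.Pointwise using (Pointwise; []; _∷_)
open import Data.Nat
open import Data.Nat.DivMod
open import Data.Nat.GeneralisedArithmetic using (fold; fold-+)
open import Data.Nat.Properties
open import Data.Product using (Σ; _×_; _,_; proj₁; proj₂)
open import Data.Sum using (_⊎_; inj₁; inj₂; [_,_]′)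
open import Data.Unit using (⊤; tt)
open import Function.Bundles using (Equivalence)
open import Relation.Binary.Construct.Closure.ReflexiveTransitive using (Star; ε; _◅_; _◅◅_)
open import Relation.Binary.Definitions using (tri<; tri≈; tri>)
open import Relation.Binary.PropositionalEquality hiding (_≗_)
open import Relation.Nullary using (¬_; contradiction)

open import Defs

-- Cantor pairing and Gödel numbering

unpair₁ unpair₂ : ℕ → ℕ
unpair₁ n = proj₁ (unpair n)
unpair₂ n = proj₂ (unpair n)

pair-suc-zero : ∀ b → pair 0 (suc b) ≡ suc (pair b 0)
pair-suc-zero b = begin
  tri (suc b) + 0     ≡⟨ +-identityʳ _ ⟩
  tri b + suc b       ≡⟨ +-suc (tri b) b ⟩
  suc (tri b + b)     ≡⟨ cong (λ s → suc (tri s + b)) (+-identityʳ b) ⟨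
  suc (pair b 0)      ∎
  where open ≡-Reasoning

pair-suc-suc : ∀ a b → pair (suc a) b ≡ suc (pair a (suc b))
pair-suc-suc a b = begin
  tri (suc (a + b)) + suc a   ≡⟨ cong (λ s → tri s + suc a) (+-suc a b) ⟨
  tri (a + suc b) + suc a     ≡⟨ +-suc _ a ⟩
  suc (pair a (suc b))        ∎
  where open ≡-Reasoning

unpair-pair : ∀ a b → unpair (pair a b) ≡ (a , b)
unpair-pair a b = go (a + b) a b refl
  where
  go : ∀ s a b → a + b ≡ s → unpair (pair a b) ≡ (a , b)
  go zero    zero    zero    _ = refl
  go zero    zero    (suc b) ()
  go (suc s) zero    zero    ()
  go (suc s) zero    (suc b) e
    rewrite pair-suc-zero b | go s b 0 (trans (+-identityʳ b) (suc-injective e)) = refl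
  go s       (suc a) b       e
    rewrite pair-suc-suc a b | go s a (suc b) (trans (+-suc a b) e) = refl

unpair₁-pair : ∀ a b → unpair₁ (pair a b) ≡ a
unpair₁-pair a b = cong proj₁ (unpair-pair a b)

unpair₂-pair : ∀ a b → unpair₂ (pair a b) ≡ b
unpair₂-pair a b = cong proj₂ (unpair-pair a b)

pair-unpair : ∀ n → pair (unpair₁ n) (unpair₂ n) ≡ n
pair-unpair zero = refl
pair-unpair (suc n) with unpair n | pair-unpair n
... | a , suc b | e = trans (pair-suc-suc a b) (cong suc e)
... | a , zero  | e = trans (pair-suc-zero a) (cong suc e)

n≤tri[n] : ∀ n → n ≤ tri n
n≤tri[n] zero    = z≤n
n≤tri[n] (suc n) = ≤-trans (s≤s (m≤n+m n (tri n))) (≤-reflexive (sym (+-suc (tri n) n)))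

unpair₁-≤ : ∀ n → unpair₁ n ≤ n
unpair₁-≤ n = ≤-trans (m≤n+m _ _) (≤-reflexive (pair-unpair n))

unpair₂-≤ : ∀ n → unpair₂ n ≤ n
unpair₂-≤ n = begin
  unpair₂ n                                  ≤⟨ m≤n+m _ (unpair₁ n) ⟩
  unpair₁ n + unpair₂ n                      ≤⟨ n≤tri[n] _ ⟩
  tri (unpair₁ n + unpair₂ n)                ≤⟨ m≤m+n _ (unpair₁ n) ⟩
  pair (unpair₁ n) (unpair₂ n)               ≡⟨ pair-unpair n ⟩
  n                                          ∎
  where open ≤-Reasoning

codeOfTag : ℕ → Code → Code → Code
codeOfTag 0 a b = cZero
codeOfTag 1 a b = cSucc
codeOfTag 2 a b = cId
codeOfTag 3 a b = cFst
codeOfTag 4 a b = cSnd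
codeOfTag 5 a b = cOracle
codeOfTag 6 a b = cComp a b
codeOfTag 7 a b = cPair a b
codeOfTag 8 a b = cRec a b
codeOfTag _ a b = cMin a

tag : Code → ℕ
tag cZero       = 0
tag cSucc       = 1
tag cId         = 2
tag cFst        = 3
tag cSnd        = 4
tag cOracle     = 5
tag (cComp _ _) = 6
tag (cPair _ _) = 7
tag (cRec _ _)  = 8
tag (cMin _)    = 9

tag-codeOfTag : ∀ t a b → tag (codeOfTag t a b) ≡ 9 ⊓ t
tag-codeOfTag 0 a b = refl
tag-codeOfTag 1 a b = refl
tag-codeOfTag 2 a b = refl
tag-codeOfTag 3 a b = refl
tag-codeOfTag 4 a b = refl
tag-codeOfTag 5 a b = refl
tag-codeOfTag 6 a b = refl
tag-codeOfTag 7 a b = refl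
tag-codeOfTag 8 a b = refl
tag-codeOfTag (suc (suc (suc (suc (suc (suc (suc (suc (suc _)))))))))  a b = refl

-- The index suc k has tag k % 10 and children indices child₁ k, child₂ k.
child₁ child₂ : ℕ → ℕ
child₁ k = unpair₁ (k / 10)
child₂ k = unpair₂ (k / 10)

child₁-≤ : ∀ k → child₁ k ≤ k
child₁-≤ k = ≤-trans (unpair₁-≤ _) (m/n≤m k 10)

child₂-≤ : ∀ k → child₂ k ≤ k
child₂-≤ k = ≤-trans (unpair₂-≤ _) (m/n≤m k 10)

decodeFuel-suc : ∀ f k → decodeFuel (suc f) (suc k)
               ≡ codeOfTag (k % 10) (decodeFuel f (child₁ k)) (decodeFuel f (child₂ k))
decodeFuel-suc f k with k % 10
... | 0 = refl
... | 1 = refl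
... | 2 = refl
... | 3 = refl
... | 4 = refl
... | 5 = refl
... | 6 = refl
... | 7 = refl
... | 8 = refl
... | suc (suc (suc (suc (suc (suc (suc (suc (suc _)))))))) = refl

decodeFuel-stable : ∀ f₁ f₂ n → n ≤ f₁ → n ≤ f₂ → decodeFuel f₁ n ≡ decodeFuel f₂ n
decodeFuel-stable zero     zero     n       _       _       = refl
decodeFuel-stable zero     (suc f₂) zero    _       _       = refl
decodeFuel-stable (suc f₁) zero     zero    _       _       = refl
decodeFuel-stable (suc f₁) (suc f₂) zero    _       _       = refl
decodeFuel-stable (suc f₁) (suc f₂) (suc k) (s≤s p) (s≤s q) = begin
  decodeFuel (suc f₁) (suc k)                                        ≡⟨ decodeFuel-suc f₁ k ⟩
  codeOfTag (k % 10) (decodeFuel f₁ (child₁ k)) (decodeFuel f₁ (child₂ k))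
    ≡⟨ cong₂ (codeOfTag (k % 10)) (stable (child₁-≤ k)) (stable (child₂-≤ k)) ⟩
  codeOfTag (k % 10) (decodeFuel f₂ (child₁ k)) (decodeFuel f₂ (child₂ k)) ≡⟨ decodeFuel-suc f₂ k ⟨
  decodeFuel (suc f₂) (suc k)                                        ∎
  where
  open ≡-Reasoning
  stable : ∀ {m} → m ≤ k → decodeFuel f₁ m ≡ decodeFuel f₂ m
  stable m≤k = decodeFuel-stable f₁ f₂ _ (≤-trans m≤k p) (≤-trans m≤k q)

decode-suc : ∀ k → decode (suc k) ≡ codeOfTag (k % 10) (decode (child₁ k)) (decode (child₂ k))
decode-suc k = trans (decodeFuel-suc k k)
  (cong₂ (codeOfTag (k % 10)) (decodeFuel-stable k _ _ (child₁-≤ k) ≤-refl)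
                              (decodeFuel-stable k _ _ (child₂-≤ k) ≤-refl))

decode-suc-tag : ∀ {k c} → decode (suc k) ≡ c → k % 10 ≡ tag c
decode-suc-tag {k} {c} eq = begin
  k % 10                                                  ≡⟨ m≥n⇒m⊓n≡n (≤-pred (m%n<n k 10)) ⟨
  9 ⊓ (k % 10)                                            ≡⟨ tag-codeOfTag (k % 10) _ _ ⟨
  tag (codeOfTag (k % 10) (decode (child₁ k)) (decode (child₂ k)))
    ≡⟨ cong tag (trans (sym (decode-suc k)) eq) ⟩
  tag c                                                   ∎
  where open ≡-Reasoning

decode-suc-children : ∀ {k c} → decode (suc k) ≡ c →
  codeOfTag (tag c) (decode (child₁ k)) (decode (child₂ k)) ≡ c
decode-suc-children {k} {c} eq =
  subst (λ t → codeOfTag t _ _ ≡ c) (decode-suc-tag eq) (trans (sym (decode-suc k)) eq)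

[r+qn]%n≡r : ∀ {r} q n .{{_ : NonZero n}} → r < n → (r + q * n) % n ≡ r
[r+qn]%n≡r {r} q n r<n = trans ([m+kn]%n≡m%n r q n) (m<n⇒m%n≡m r<n)

[r+qn]/n≡q : ∀ {r} q n .{{_ : NonZero n}} → r < n → (r + q * n) / n ≡ q
[r+qn]/n≡q {r} q n r<n = begin
  (r + q * n) / n         ≡⟨ +-distrib-/ r (q * n) r%n+qn%n<n ⟩
  r / n + q * n / n       ≡⟨ cong₂ _+_ (m<n⇒m/n≡0 r<n) (m*n/n≡m q n) ⟩
  q                       ∎
  where
  open ≡-Reasoning
  r%n+qn%n<n : r % n + q * n % n < n
  r%n+qn%n<n = subst (_< n) (sym (trans (cong₂ _+_ (m<n⇒m%n≡m r<n) (m*n%n≡0 q n)) (+-identityʳ r))) r<n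

node : ℕ → ℕ → ℕ → ℕ
node t a b = suc (t + pair a b * 10)

decode-node : ∀ {t} a b → {{T (t <ᵇ 10)}} → decode (node t a b) ≡ codeOfTag t (decode a) (decode b)
decode-node {t} a b {{t<ᵇ10}}
  rewrite decode-suc (t + pair a b * 10)
        | [r+qn]%n≡r (pair a b) 10 (<ᵇ⇒< t 10 t<ᵇ10) | [r+qn]/n≡q (pair a b) 10 (<ᵇ⇒< t 10 t<ᵇ10)
        | unpair-pair a b = refl

encode : Code → ℕ
encode cZero       = 0
encode cSucc       = 2
encode cId         = 3
encode cFst        = 4
encode cSnd        = 5
encode cOracle     = 6
encode (cComp a b) = node 6 (encode a) (encode b)
encode (cPair a b) = node 7 (encode a) (encode b)
encode (cRec a b)  = node 8 (encode a) (encode b)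
encode (cMin a)    = node 9 (encode a) 0

decode-encode : ∀ c → decode (encode c) ≡ c
decode-encode cZero       = refl
decode-encode cSucc       = refl
decode-encode cId         = refl
decode-encode cFst        = refl
decode-encode cSnd        = refl
decode-encode cOracle     = refl
decode-encode (cComp a b) =
  trans (decode-node (encode a) (encode b)) (cong₂ cComp (decode-encode a) (decode-encode b))
decode-encode (cPair a b) =
  trans (decode-node (encode a) (encode b)) (cong₂ cPair (decode-encode a) (decode-encode b))
decode-encode (cRec a b)  =
  trans (decode-node (encode a) (encode b)) (cong₂ cRec (decode-encode a) (decode-encode b))
decode-encode (cMin a)    = trans (decode-node (encode a) 0) (cong cMin (decode-encode a))

mutual
  eval-deterministic : ∀ {O c x y y′} → Eval O c x y → Eval O c x y′ → y ≡ y′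
  eval-deterministic eZero         eZero         = refl
  eval-deterministic eSucc         eSucc         = refl
  eval-deterministic eId           eId           = refl
  eval-deterministic eFst          eFst          = refl
  eval-deterministic eSnd          eSnd          = refl
  eval-deterministic eOracle       eOracle       = refl
  eval-deterministic (eComp d₁ d₂) (eComp e₁ e₂)
    rewrite eval-deterministic d₁ e₁ = eval-deterministic d₂ e₂
  eval-deterministic (ePair d₁ d₂) (ePair e₁ e₂) =
    cong₂ pair (eval-deterministic d₁ e₁) (eval-deterministic d₂ e₂)
  eval-deterministic (eRec r)      (eRec r′)     = recEval-deterministic r r′
  eval-deterministic (eMin {n = n} d h) (eMin {n = n′} d′ h′) with <-cmp n n′
  ... | tri< n<n′ _ _ = contradiction (eval-deterministic d (proj₂ (h′ n n<n′))) λ ()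
  ... | tri≈ _ n≡n′ _ = n≡n′
  ... | tri> _ _ n>n′ = contradiction (eval-deterministic (proj₂ (h n′ n>n′)) d′) λ ()

  recEval-deterministic : ∀ {O f g x n y y′} → RecEval O f g x n y → RecEval O f g x n y′ → y ≡ y′
  recEval-deterministic (rZero d)   (rZero d′)    = eval-deterministic d d′
  recEval-deterministic (rSuc r d) (rSuc r′ d′) rewrite recEval-deterministic r r′ = eval-deterministic d d′

-- An opaque copy of the pairing function: unification then treats ⟨ a , b ⟩ as rigid
-- instead of unfolding Cantor pairing into arithmetic.
opaque
  ⟨_,_⟩ : ℕ → ℕ → ℕ
  ⟨_,_⟩ = pair

  ⟨,⟩≡pair : ∀ a b → ⟨ a , b ⟩ ≡ pair a b
  ⟨,⟩≡pair a b = refl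

  ⟨,⟨,⟩⟩≡pair : ∀ a b c → ⟨ a , ⟨ b , c ⟩ ⟩ ≡ pair a (pair b c)
  ⟨,⟨,⟩⟩≡pair a b c = refl

infixr 9 _∘c_
_∘c_ : Code → Code → Code
f ∘c g = cComp f g

module _ {O : Subset} where

  eval-fst : ∀ {a b} → Eval O cFst ⟨ a , b ⟩ a
  eval-fst {a} {b} = subst (λ n → Eval O cFst n a) (sym (⟨,⟩≡pair a b))
                       (subst (Eval O cFst (pair a b)) (unpair₁-pair a b) eFst)

  eval-snd : ∀ {a b} → Eval O cSnd ⟨ a , b ⟩ b
  eval-snd {a} {b} = subst (λ n → Eval O cSnd n b) (sym (⟨,⟩≡pair a b))
                       (subst (Eval O cSnd (pair a b)) (unpair₂-pair a b) eSnd)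

  eval-pair : ∀ {f g x y z} → Eval O f x y → Eval O g x z → Eval O (cPair f g) x ⟨ y , z ⟩
  eval-pair {y = y} {z} df dg = subst (Eval O _ _) (sym (⟨,⟩≡pair y z)) (ePair df dg)

  eval-rec : ∀ {f g a b y} → RecEval O f g a b y → Eval O (cRec f g) ⟨ a , b ⟩ y
  eval-rec {f} {g} {a} {b} {y} r = subst (λ n → Eval O (cRec f g) n y) (sym (⟨,⟩≡pair a b))
    (eRec (subst₂ (λ u v → RecEval O f g u v y) (sym (unpair₁-pair a b)) (sym (unpair₂-pair a b)) r))

  rec-suc : ∀ {f g x n r y} → RecEval O f g x n r → Eval O g ⟨ x , ⟨ n , r ⟩ ⟩ y →
    RecEval O f g x (suc n) y
  rec-suc {g = g} {x} {n} {r} {y} rn dg = rSuc rn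
    (subst (λ m → Eval O g m y) (⟨,⟨,⟩⟩≡pair x n r) dg)

recOn : Code → Code → Code
recOn z s = cRec z (s ∘c cSnd) ∘c cPair cZero cId

recOn-correct : ∀ {O z s} (h : ℕ → ℕ) → Eval O z 0 (h 0) → (∀ n → Eval O s ⟨ n , h n ⟩ (h (suc n))) →
  ∀ n → Eval O (recOn z s) n (h n)
recOn-correct {O} {z} {s} h dz ds n = eComp (eval-pair eZero eId) (eval-rec (iterates n))
  where
  iterates : ∀ n → RecEval O z (s ∘c cSnd) 0 n (h n)
  iterates zero    = rZero dz
  iterates (suc n) = rec-suc (iterates n) (eComp eval-snd (ds n))

-- Built from cRec, so a must be defined even when t is nonzero and b is taken.
ifZero : Code → Code → Code → Code
ifZero t a b = cRec a (b ∘c cFst) ∘c cPair cId t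

module _ {O : Subset} {t a b : Code} {x : ℕ} where

  ifZero-zero : ∀ {y} → Eval O t x 0 → Eval O a x y → Eval O (ifZero t a b) x y
  ifZero-zero dt da = eComp (eval-pair eId dt) (eval-rec (rZero da))

  ifZero-suc : ∀ {n y} → Eval O t x (suc n) → Σ ℕ (Eval O a x) → Eval O b x y → Eval O (ifZero t a b) x y
  ifZero-suc {n} {y} dt (_ , da) db = eComp (eval-pair eId dt) (eval-rec (proj₂ (upTo (suc n))))
    where
    upTo : ∀ m → Σ ℕ (RecEval O a (b ∘c cFst) x m)
    upTo zero    = _ , rZero da
    upTo (suc m) = y , rec-suc (proj₂ (upTo m)) (eComp eval-fst db)

isTotal : Code → Bool
isTotal cZero       = true
isTotal cSucc       = true
isTotal cId         = true
isTotal cFst        = true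
isTotal cSnd        = true
isTotal cOracle     = false
isTotal (cComp f g) = isTotal f ∧ isTotal g
isTotal (cPair f g) = isTotal f ∧ isTotal g
isTotal (cRec f g)  = isTotal f ∧ isTotal g
isTotal (cMin f)    = false

Total : Code → Set
Total c = ∀ x → Σ ℕ λ y → ∀ O → Eval O c x y

isTotal⇒Total : ∀ c → T (isTotal c) → Total c
isTotal⇒Total cZero       _ x = 0 , λ _ → eZero
isTotal⇒Total cSucc       _ x = suc x , λ _ → eSucc
isTotal⇒Total cId         _ x = x , λ _ → eId
isTotal⇒Total cFst        _ x = _ , λ _ → eFst
isTotal⇒Total cSnd        _ x = _ , λ _ → eSnd
isTotal⇒Total (cComp f g) p x =
  let (tf , tg) = Equivalence.to T-∧ p
      (y , dg) = isTotal⇒Total g tg x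
      (z , df) = isTotal⇒Total f tf y
  in z , λ O → eComp (dg O) (df O)
isTotal⇒Total (cPair f g) p x =
  let (tf , tg) = Equivalence.to T-∧ p
      (y , df) = isTotal⇒Total f tf x
      (z , dg) = isTotal⇒Total g tg x
  in pair y z , λ O → ePair (df O) (dg O)
isTotal⇒Total (cRec f g) p x = let (y , d) = upTo (unpair₂ x) in y , λ O → eRec (d O)
  where
  upTo : ∀ n → Σ ℕ λ y → ∀ O → RecEval O f g (unpair₁ x) n y
  upTo zero    = let (y , d) = isTotal⇒Total f (proj₁ (Equivalence.to T-∧ p)) (unpair₁ x)
                 in y , λ O → rZero (d O)
  upTo (suc n) = let (r , dr) = upTo n
                     (y , d) = isTotal⇒Total g (proj₂ (Equivalence.to T-∧ p)) (pair (unpair₁ x) (pair n r))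
                 in y , λ O → rSuc (dr O) (d O)

isTotal⇒defined : ∀ {O} c → T (isTotal c) → ∀ x → Σ ℕ (Eval O c x)
isTotal⇒defined {O} c p x = let (y , d) = isTotal⇒Total c p x in y , d O

const : ℕ → Code
const zero    = cZero
const (suc n) = cSucc ∘c const n

eval-const : ∀ {O x} n → Eval O (const n) x n
eval-const zero    = eZero
eval-const (suc n) = eComp (eval-const n) eSucc

predCode : Code
predCode = recOn cZero cFst

eval-pred : ∀ {O} n → Eval O predCode n (pred n)
eval-pred = recOn-correct pred eZero (λ _ → eval-fst)

-- The remainder r is kept as d ∸ r and counted down, so that no comparison with d is needed.
countdown : ℕ → Code
countdown d = ifZero cSnd (cPair (cSucc ∘c cFst) (const d)) (cPair cFst (predCode ∘c cSnd))

divModCode : ℕ → Code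
divModCode d = recOn (cPair cZero (const d)) (countdown d ∘c cSnd)

eval-countdown : ∀ {O} d n →
  Eval O (countdown d) ⟨ n / suc d , d ∸ n % suc d ⟩ ⟨ suc n / suc d , d ∸ suc n % suc d ⟩
eval-countdown {O} d n =
  subst (λ m → Eval O (countdown d) ⟨ m / suc d , d ∸ m % suc d ⟩ ⟨ suc m / suc d , d ∸ suc m % suc d ⟩)
        (sym (m≡m%n+[m/n]*n n (suc d)))
        (go (n % suc d) (n / suc d) (m%n<n n (suc d)))
  where
  go : ∀ r q → r < suc d →
    Eval O (countdown d) ⟨ (r + q * suc d) / suc d , d ∸ (r + q * suc d) % suc d ⟩
                         ⟨ suc (r + q * suc d) / suc d , d ∸ suc (r + q * suc d) % suc d ⟩
  go r q r<1+d rewrite [r+qn]/n≡q q (suc d) r<1+d | [r+qn]%n≡r q (suc d) r<1+d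
    with m<1+n⇒m<n∨m≡n r<1+d
  ... | inj₁ r<d rewrite [r+qn]/n≡q q (suc d) (s≤s r<d) | [r+qn]%n≡r q (suc d) (s≤s r<d)
                       | +-∸-assoc 1 r<d =
    ifZero-suc eval-snd (_ , eval-pair (eComp eval-fst eSucc) (eval-const d))
               (eval-pair eval-fst (eComp eval-snd (eval-pred (suc (d ∸ suc r)))))
  ... | inj₂ refl rewrite [r+qn]/n≡q {0} (suc q) (suc r) z<s | [r+qn]%n≡r {0} (suc q) (suc r) z<s
                        | n∸n≡0 r =
    ifZero-zero eval-snd (eval-pair (eComp eval-fst eSucc) (eval-const r))

eval-divModCode : ∀ {O} d n → Eval O (divModCode d) n ⟨ n / suc d , d ∸ n % suc d ⟩
eval-divModCode d = recOn-correct (λ n → ⟨ n / suc d , d ∸ n % suc d ⟩)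
  (eval-pair eZero (eval-const d)) (λ n → eComp eval-snd (eval-countdown d n))

allTotal : List Code → Bool
allTotal []       = true
allTotal (b ∷ bs) = isTotal b ∧ allTotal bs

switch : Code → List Code → Code
switch t []               = cZero
switch t (b ∷ [])         = b
switch t (b ∷ bs@(_ ∷ _)) = ifZero t b (switch (predCode ∘c t) bs)

-- Indices past the end select the last branch.
branch : List Code → ℕ → Code
branch []               n       = cZero
branch (b ∷ [])         n       = b
branch (b ∷ bs@(_ ∷ _)) zero    = b
branch (b ∷ bs@(_ ∷ _)) (suc n) = branch bs n

switch-correct : ∀ {O t x y} bs n → T (allTotal bs) → Eval O t x n → Eval O (branch bs n) x y →
  Eval O (switch t bs) x y
switch-correct []               n       _ _  d = d
switch-correct (b ∷ [])         n       _ _  d = d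
switch-correct (b ∷ bs@(_ ∷ _)) zero    _ dt d = ifZero-zero dt d
switch-correct (b ∷ bs@(_ ∷ _)) (suc n) p dt d =
  ifZero-suc dt (isTotal⇒defined b (proj₁ tb) _)
    (switch-correct bs n (proj₂ tb) (eComp dt (eval-pred (suc n))) d)
  where tb = Equivalence.to T-∧ p

tuple : List ℕ → ℕ → ℕ
tuple []       t = t
tuple (a ∷ as) t = ⟨ a , tuple as t ⟩

tupleCode : List Code → Code → Code
tupleCode []       t = t
tupleCode (c ∷ cs) t = cPair c (tupleCode cs t)

after : ℕ → Code
after zero    = cId
after (suc i) = after i ∘c cSnd

at : ℕ → Code
at i = cFst ∘c after i

-- The first i components of a tuple, as a nested Σ-type (with η) so that eval-at i and
-- eval-after i infer them by unification.
Prefix : ℕ → Set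
Prefix zero    = ⊤
Prefix (suc i) = ℕ × Prefix i

tuple′ : ∀ i → Prefix i → ℕ → ℕ
tuple′ zero    _        t = t
tuple′ (suc i) (a , as) t = ⟨ a , tuple′ i as t ⟩

module _ {O : Subset} where

  eval-after : ∀ i {as : Prefix i} {t} → Eval O (after i) (tuple′ i as t) t
  eval-after zero    = eId
  eval-after (suc i) = eComp eval-snd (eval-after i)

  eval-at : ∀ i {as : Prefix i} {a t} → Eval O (at i) (tuple′ i as ⟨ a , t ⟩) a
  eval-at i = eComp (eval-after i) eval-fst

  eval-tuple : ∀ {cs vs c v x} → Pointwise (λ c v → Eval O c x v) cs vs → Eval O c x v →
    Eval O (tupleCode cs c) x (tuple vs v)
  eval-tuple []         d = d
  eval-tuple (dc ∷ dcs) d = eval-pair dc (eval-tuple dcs d)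

-- A universal machine

-- A machine state is ⟨ 0 , e , x , K ⟩ (evaluate the code with index e on x, then continue
-- with K) or ⟨ 1 , y , K ⟩ (return the value y to K).
evalState : ℕ → ℕ → ℕ → ℕ
evalState e x K = tuple (0 ∷ e ∷ x ∷ []) K

returnState : ℕ → ℕ → ℕ
returnState y K = tuple (1 ∷ y ∷ []) K

-- Continuation frames.  In recK g x i n K the step function g has been applied i times
-- and n more applications are pending; minK f x n K is waiting for the value of f ⟨ x , n ⟩.
haltK : ℕ
haltK = ⟨ 0 , 0 ⟩

compK : ℕ → ℕ → ℕ
compK f K = tuple (1 ∷ f ∷ []) K

pairLK : ℕ → ℕ → ℕ → ℕ
pairLK g x K = tuple (2 ∷ g ∷ x ∷ []) K

pairRK : ℕ → ℕ → ℕ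
pairRK y K = tuple (3 ∷ y ∷ []) K

recK : ℕ → ℕ → ℕ → ℕ → ℕ → ℕ
recK g x i n K = tuple (4 ∷ g ∷ x ∷ i ∷ n ∷ []) K

minK : ℕ → ℕ → ℕ → ℕ → ℕ
minK f x n K = tuple (5 ∷ f ∷ x ∷ n ∷ []) K

-- The machine simulates computations relative to the empty oracle, so an oracle query returns 0.
infix 4 _⟶_
data _⟶_ : ℕ → ℕ → Set where
  start-index-zero : ∀ {x K} → evalState 0 x K ⟶ returnState 0 K
  start-zero   : ∀ {k x K} → k % 10 ≡ 0 → evalState (suc k) x K ⟶ returnState 0 K
  start-succ   : ∀ {k x K} → k % 10 ≡ 1 → evalState (suc k) x K ⟶ returnState (suc x) K
  start-id     : ∀ {k x K} → k % 10 ≡ 2 → evalState (suc k) x K ⟶ returnState x K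
  start-fst    : ∀ {k x K} → k % 10 ≡ 3 → evalState (suc k) x K ⟶ returnState (unpair₁ x) K
  start-snd    : ∀ {k x K} → k % 10 ≡ 4 → evalState (suc k) x K ⟶ returnState (unpair₂ x) K
  start-oracle : ∀ {k x K} → k % 10 ≡ 5 → evalState (suc k) x K ⟶ returnState 0 K
  start-comp   : ∀ {k x K} → k % 10 ≡ 6 →
                 evalState (suc k) x K ⟶ evalState (child₂ k) x (compK (child₁ k) K)
  start-pair   : ∀ {k x K} → k % 10 ≡ 7 →
                 evalState (suc k) x K ⟶ evalState (child₁ k) x (pairLK (child₂ k) x K)
  start-rec    : ∀ {k x K} → k % 10 ≡ 8 →
                 evalState (suc k) x K ⟶
                 evalState (child₁ k) (unpair₁ x) (recK (child₂ k) (unpair₁ x) 0 (unpair₂ x) K)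
  start-min    : ∀ {k x K} → k % 10 ≡ 9 →
                 evalState (suc k) x K ⟶ evalState (child₁ k) ⟨ x , 0 ⟩ (minK (child₁ k) x 0 K)
  resume-comp  : ∀ {y f K} → returnState y (compK f K) ⟶ evalState f y K
  resume-pairL : ∀ {y g x K} → returnState y (pairLK g x K) ⟶ evalState g x (pairRK y K)
  resume-pairR : ∀ {z y K} → returnState z (pairRK y K) ⟶ returnState ⟨ y , z ⟩ K
  resume-rec-done : ∀ {y g x i K} → returnState y (recK g x i 0 K) ⟶ returnState y K
  resume-rec-next : ∀ {y g x i n K} →
                    returnState y (recK g x i (suc n) K) ⟶
                    evalState g ⟨ x , ⟨ i , y ⟩ ⟩ (recK g x (suc i) n K)
  resume-min-found : ∀ {f x n K} → returnState 0 (minK f x n K) ⟶ returnState n K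
  resume-min-next  : ∀ {v f x n K} →
                     returnState (suc v) (minK f x n K) ⟶ evalState f ⟨ x , suc n ⟩ (minK f x (suc n) K)

evalCode : Code → Code → Code → Code
evalCode e x K = tupleCode (cZero ∷ e ∷ x ∷ []) K

returnCode : Code → Code → Code
returnCode y K = tupleCode (const 1 ∷ y ∷ []) K

digitsCode child₁Code child₂Code inputCode contCode : Code
digitsCode = divModCode 9 ∘c predCode ∘c at 1
child₁Code = cFst ∘c cFst ∘c digitsCode
child₂Code = cSnd ∘c cFst ∘c digitsCode
inputCode  = at 2
contCode   = after 3

-- Indexed by 9 ∸ tag, the form in which divModCode delivers the tag.
startBranches : List Code
startBranches =
  evalCode child₁Code (cPair inputCode cZero)
    (tupleCode (const 5 ∷ child₁Code ∷ inputCode ∷ cZero ∷ []) contCode) ∷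
  evalCode child₁Code (cFst ∘c inputCode)
    (tupleCode (const 4 ∷ child₂Code ∷ cFst ∘c inputCode ∷ cZero ∷ cSnd ∘c inputCode ∷ []) contCode) ∷
  evalCode child₁Code inputCode (tupleCode (const 2 ∷ child₂Code ∷ inputCode ∷ []) contCode) ∷
  evalCode child₂Code inputCode (tupleCode (const 1 ∷ child₁Code ∷ []) contCode) ∷
  returnCode cZero contCode ∷
  returnCode (cSnd ∘c inputCode) contCode ∷
  returnCode (cFst ∘c inputCode) contCode ∷
  returnCode inputCode contCode ∷
  returnCode (cSucc ∘c inputCode) contCode ∷
  returnCode cZero contCode ∷ []

-- Indexed by the frame tag; the halting frame leaves the state unchanged.
resumeBranches : List Code
resumeBranches =
  cId ∷
  evalCode (at 3) (at 1) (after 4) ∷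
  evalCode (at 3) (at 4) (tupleCode (const 3 ∷ at 1 ∷ []) (after 5)) ∷
  returnCode (cPair (at 3) (at 1)) (after 4) ∷
  ifZero (at 6) (returnCode (at 1) (after 7))
    (evalCode (at 3) (tupleCode (at 4 ∷ at 5 ∷ []) (at 1))
      (tupleCode (const 4 ∷ at 3 ∷ at 4 ∷ cSucc ∘c at 5 ∷ predCode ∘c at 6 ∷ []) (after 7))) ∷
  ifZero (at 1) (returnCode (at 5) (after 6))
    (evalCode (at 3) (cPair (at 4) (cSucc ∘c at 5))
      (tupleCode (const 5 ∷ at 3 ∷ at 4 ∷ cSucc ∘c at 5 ∷ []) (after 6))) ∷ []

stepCode : Code
stepCode = ifZero (at 0)
  (ifZero (at 1) (returnCode cZero contCode) (switch (cSnd ∘c digitsCode) startBranches))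
  (switch (at 2) resumeBranches)

step : ℕ → ℕ
step s = proj₁ (isTotal⇒Total stepCode tt s)

step-≡ : ∀ {s s′} → Eval ∅ stepCode s s′ → step s ≡ s′
step-≡ {s} = eval-deterministic (proj₂ (isTotal⇒Total stepCode tt s) ∅)

module _ {O : Subset} {s : ℕ} where

  eval-evalCode : ∀ {e x K a b c} → Eval O e s a → Eval O x s b → Eval O K s c →
    Eval O (evalCode e x K) s (evalState a b c)
  eval-evalCode de dx dK = eval-tuple (eZero ∷ de ∷ dx ∷ []) dK

  eval-returnCode : ∀ {y K a c} → Eval O y s a → Eval O K s c → Eval O (returnCode y K) s (returnState a c)
  eval-returnCode dy dK = eval-tuple (eval-const 1 ∷ dy ∷ []) dK

module _ {O : Subset} {k x K : ℕ} where
  private s = evalState (suc k) x K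

  eval-digits : Eval O digitsCode s ⟨ k / 10 , 9 ∸ k % 10 ⟩
  eval-digits = eComp (eComp (eval-at 1) (eval-pred (suc k))) (eval-divModCode 9 k)

  eval-child₁ : Eval O child₁Code s (child₁ k)
  eval-child₁ = eComp (eComp eval-digits eval-fst) eFst

  eval-child₂ : Eval O child₂Code s (child₂ k)
  eval-child₂ = eComp (eComp eval-digits eval-fst) eSnd

  eval-input : Eval O inputCode s x
  eval-input = eval-at 2

  eval-cont : Eval O contCode s K
  eval-cont = eval-after 3

step-start : ∀ {k x K s′} t → k % 10 ≡ t →
  Eval ∅ (branch startBranches (9 ∸ t)) (evalState (suc k) x K) s′ → step (evalState (suc k) x K) ≡ s′
step-start {k} _ refl d = step-≡
  (ifZero-zero (eval-at 0)
    (ifZero-suc (eval-at 1) (isTotal⇒defined _ tt _)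
      (switch-correct startBranches (9 ∸ k % 10) tt (eComp eval-digits eval-snd) d)))

step-resume : ∀ {y kt pl s′} → Eval ∅ (branch resumeBranches kt) (returnState y ⟨ kt , pl ⟩) s′ →
  step (returnState y ⟨ kt , pl ⟩) ≡ s′
step-resume {kt = kt} d = step-≡
  (ifZero-suc (eval-at 0) (isTotal⇒defined _ tt _) (switch-correct resumeBranches kt tt (eval-at 2) d))

step-complete : ∀ {s s′} → s ⟶ s′ → step s ≡ s′
step-complete start-index-zero = step-≡
  (ifZero-zero (eval-at 0) (ifZero-zero (eval-at 1) (eval-returnCode eZero (eval-after 3))))
step-complete (start-zero tag≡) =
  step-start 0 tag≡ (eval-returnCode eZero eval-cont)
step-complete (start-succ tag≡) =
  step-start 1 tag≡ (eval-returnCode (eComp eval-input eSucc) eval-cont)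
step-complete (start-id tag≡) =
  step-start 2 tag≡ (eval-returnCode eval-input eval-cont)
step-complete (start-fst tag≡) =
  step-start 3 tag≡ (eval-returnCode (eComp eval-input eFst) eval-cont)
step-complete (start-snd tag≡) =
  step-start 4 tag≡ (eval-returnCode (eComp eval-input eSnd) eval-cont)
step-complete (start-oracle tag≡) =
  step-start 5 tag≡ (eval-returnCode eZero eval-cont)
step-complete (start-comp tag≡) =
  step-start 6 tag≡ (eval-evalCode eval-child₂ eval-input
    (eval-tuple (eval-const 1 ∷ eval-child₁ ∷ []) eval-cont))
step-complete (start-pair tag≡) =
  step-start 7 tag≡ (eval-evalCode eval-child₁ eval-input
    (eval-tuple (eval-const 2 ∷ eval-child₂ ∷ eval-input ∷ []) eval-cont))
step-complete (start-rec tag≡) =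
  step-start 8 tag≡ (eval-evalCode eval-child₁ (eComp eval-input eFst)
    (eval-tuple (eval-const 4 ∷ eval-child₂ ∷ eComp eval-input eFst ∷ eZero ∷ eComp eval-input eSnd ∷ [])
                eval-cont))
step-complete (start-min tag≡) =
  step-start 9 tag≡ (eval-evalCode eval-child₁ (eval-pair eval-input eZero)
    (eval-tuple (eval-const 5 ∷ eval-child₁ ∷ eval-input ∷ eZero ∷ []) eval-cont))
step-complete resume-comp = step-resume
  (eval-evalCode (eval-at 3) (eval-at 1) (eval-after 4))
step-complete resume-pairL = step-resume
  (eval-evalCode (eval-at 3) (eval-at 4)
    (eval-tuple (eval-const 3 ∷ eval-at 1 ∷ []) (eval-after 5)))
step-complete resume-pairR = step-resume
  (eval-returnCode (eval-pair (eval-at 3) (eval-at 1)) (eval-after 4))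
step-complete resume-rec-done = step-resume
  (ifZero-zero (eval-at 6)
    (eval-returnCode (eval-at 1) (eval-after 7)))
step-complete (resume-rec-next {n = n}) = step-resume
  (ifZero-suc (eval-at 6) (isTotal⇒defined _ tt _)
    (eval-evalCode (eval-at 3)
      (eval-tuple (eval-at 4 ∷ eval-at 5 ∷ []) (eval-at 1))
      (eval-tuple (eval-const 4 ∷ eval-at 3 ∷ eval-at 4
                  ∷ eComp (eval-at 5) eSucc
                  ∷ eComp (eval-at 6) (eval-pred (suc n)) ∷ [])
        (eval-after 7))))
step-complete resume-min-found = step-resume
  (ifZero-zero (eval-at 1)
    (eval-returnCode (eval-at 5) (eval-after 6)))
step-complete resume-min-next = step-resume
  (ifZero-suc (eval-at 1) (isTotal⇒defined _ tt _)
    (eval-evalCode (eval-at 3)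
      (eval-pair (eval-at 4) (eComp (eval-at 5) eSucc))
      (eval-tuple (eval-const 5 ∷ eval-at 3 ∷ eval-at 4
                  ∷ eComp (eval-at 5) eSucc ∷ [])
        (eval-after 6))))

infix 4 _⟶*_
_⟶*_ : ℕ → ℕ → Set
_⟶*_ = Star _⟶_

mutual
  simulate : ∀ {c x y} e → decode e ≡ c → Eval ∅ c x y → ∀ K → evalState e x K ⟶* returnState y K
  simulate zero    refl eZero          K = start-index-zero ◅ ε
  simulate (suc k) eq   eZero          K = start-zero (decode-suc-tag eq) ◅ ε
  simulate (suc k) eq   eSucc          K = start-succ (decode-suc-tag eq) ◅ ε
  simulate (suc k) eq   eId            K = start-id (decode-suc-tag eq) ◅ ε
  simulate (suc k) eq   eFst           K = start-fst (decode-suc-tag eq) ◅ ε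
  simulate (suc k) eq   eSnd           K = start-snd (decode-suc-tag eq) ◅ ε
  simulate (suc k) eq   eOracle        K = start-oracle (decode-suc-tag eq) ◅ ε
  simulate (suc k) eq   (eComp dg df)  K with decode-suc-children eq
  ... | refl = start-comp (decode-suc-tag eq) ◅ simulate _ refl dg _ ◅◅ resume-comp ◅ simulate _ refl df K
  simulate (suc k) eq   (ePair {y = y} {z} df dg) K with decode-suc-children eq
  ... | refl = start-pair (decode-suc-tag eq) ◅ simulate _ refl df _ ◅◅
                resume-pairL ◅ simulate _ refl dg _ ◅◅
                subst (λ v → returnState z (pairRK y K) ⟶* returnState v K) (⟨,⟩≡pair y z) (resume-pairR ◅ ε)
  simulate (suc k) eq   (eRec {x = x} {y} r) K with decode-suc-children eq
  ... | refl = start-rec (decode-suc-tag eq) ◅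
                   subst (λ n → evalState (child₁ k) (unpair₁ x) (recK (child₂ k) (unpair₁ x) 0 n K) ⟶*
                                returnState y (recK (child₂ k) (unpair₁ x) (unpair₂ x) 0 K))
                         (+-identityʳ _) (simulate-rec (child₁ k) (child₂ k) refl refl r 0 K) ◅◅
                   resume-rec-done ◅ ε
  simulate (suc k) eq   (eMin {n = n} d below) K with decode-suc-children eq
  ... | refl = start-min (decode-suc-tag eq) ◅ simulate-min _ refl below d K n 0 (+-identityʳ n)

  simulate-rec : ∀ {f g x n r} a b → decode a ≡ f → decode b ≡ g → RecEval ∅ f g x n r → ∀ m K →
    evalState a x (recK b x 0 (n + m) K) ⟶* returnState r (recK b x n m K)
  simulate-rec {x = x} a b ea eb (rZero d) m K = simulate a ea d (recK b x 0 m K)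
  simulate-rec {x = x} a b ea eb (rSuc {n = n} {r} {y} rn dg) m K =
    subst (λ l → evalState a x (recK b x 0 l K) ⟶* returnState r (recK b x n (suc m) K)) (+-suc n m)
          (simulate-rec a b ea eb rn (suc m) K) ◅◅
    resume-rec-next ◅
    subst (λ i → evalState b i (recK b x (suc n) m K) ⟶* returnState y (recK b x (suc n) m K))
          (sym (⟨,⟨,⟩⟩≡pair x n r)) (simulate b eb dg _)

  simulate-min : ∀ {f x n} a → decode a ≡ f → (∀ m → m < n → Σ ℕ λ v → Eval ∅ f (pair x m) (suc v)) →
    Eval ∅ f (pair x n) 0 → ∀ K j m → j + m ≡ n → evalState a ⟨ x , m ⟩ (minK a x m K) ⟶* returnState n K
  simulate-min {x = x} a ea below d K zero m refl =
    subst (λ i → evalState a i (minK a x m K) ⟶* returnState 0 (minK a x m K)) (sym (⟨,⟩≡pair x m))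
          (simulate a ea d (minK a x m K)) ◅◅
    resume-min-found ◅ ε
  simulate-min {x = x} {n} a ea below d K (suc j) m j+m≡n
    with below m (≤-trans (s≤s (m≤n+m m j)) (≤-reflexive j+m≡n))
  ... | v , dm =
    subst (λ i → evalState a i (minK a x m K) ⟶* returnState (suc v) (minK a x m K)) (sym (⟨,⟩≡pair x m))
          (simulate a ea dm (minK a x m K)) ◅◅
    resume-min-next ◅ simulate-min a ea below d K j (suc m) (trans (+-suc j m) j+m≡n)

⟶*⇒fold : ∀ {s s′} → s ⟶* s′ → Σ ℕ λ t → fold s step t ≡ s′
⟶*⇒fold ε = 0 , refl
⟶*⇒fold {s} (s⟶ ◅ run) =
  let (t , eq) = ⟶*⇒fold run
  in t + 1 , trans (fold-+ s step t) (trans (cong (λ u → fold u step t) (step-complete s⟶)) eq)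

fold-fixed : ∀ {A : Set} (f : A → A) {s} → f s ≡ s → ∀ t → fold s f t ≡ s
fold-fixed f fs≡s zero    = refl
fold-fixed f fs≡s (suc t) = trans (cong f (fold-fixed f fs≡s t)) fs≡s

-- 0 exactly on the halted states ⟨ 1 , y , 0 , _ ⟩, which step leaves unchanged.
haltTestCode : Code
haltTestCode = ifZero (predCode ∘c at 0) (ifZero (at 0) (const 1) (ifZero (at 2) cZero (const 1))) (const 1)

haltTest : ℕ → ℕ
haltTest s = proj₁ (isTotal⇒Total haltTestCode tt s)

eval-haltTest : ∀ {O} s → Eval O haltTestCode s (haltTest s)
eval-haltTest {O} s = proj₂ (isTotal⇒Total haltTestCode tt s) O

haltTest-returnState : ∀ y → haltTest (returnState y haltK) ≡ 0
haltTest-returnState y = eval-deterministic (eval-haltTest {∅} _)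
  (ifZero-zero (eComp (eval-at 0) (eval-pred 1))
    (ifZero-suc (eval-at 0) (_ , eval-const 1) (ifZero-zero (eval-at 2) eZero)))

haltTest≡0⇒step-fixed : ∀ s → haltTest s ≡ 0 → step s ≡ s
haltTest≡0⇒step-fixed s halted =
  go (unpair₁ s) (unpair₁ (unpair₂ (unpair₂ s))) (eComp eId eFst) (eComp (eComp eSnd (eComp eSnd eId)) eFst)
  where
  running : Eval ∅ haltTestCode s 1 → ⊥
  running d = contradiction (trans (sym halted) (eval-deterministic (eval-haltTest s) d)) λ ()

  go : ∀ t f → Eval ∅ (at 0) s t → Eval ∅ (at 2) s f → step s ≡ s
  go 0             _       dt df = ⊥-elim (running
    (ifZero-zero (eComp dt (eval-pred 0)) (ifZero-zero dt (eval-const 1))))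
  go 1             0       dt df =
    step-≡ (ifZero-suc dt (isTotal⇒defined _ tt _) (switch-correct resumeBranches 0 tt df eId))
  go 1             (suc _) dt df = ⊥-elim (running
    (ifZero-zero (eComp dt (eval-pred 1))
      (ifZero-suc dt (_ , eval-const 1) (ifZero-suc df (_ , eZero) (eval-const 1)))))
  go (suc (suc t)) _       dt df = ⊥-elim (running
    (ifZero-suc (eComp dt (eval-pred (suc (suc t)))) (isTotal⇒defined _ tt _) (eval-const 1)))

NonZeroBelow : (ℕ → ℕ) → ℕ → Set
NonZeroBelow f u = ∀ v → v < u → Σ ℕ λ w → f v ≡ suc w

LeastZero : (ℕ → ℕ) → ℕ → Set
LeastZero f u = f u ≡ 0 × NonZeroBelow f u

nonZeroBelow-or-leastZero : ∀ f t → NonZeroBelow f t ⊎ Σ ℕ λ u → u < t × LeastZero f u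
nonZeroBelow-or-leastZero f zero = inj₁ λ _ ()
nonZeroBelow-or-leastZero f (suc t) with nonZeroBelow-or-leastZero f t
... | inj₂ (u , u<t , least) = inj₂ (u , m<n⇒m<1+n u<t , least)
... | inj₁ below with f t in ft
...   | zero  = inj₂ (t , ≤-refl , ft , below)
...   | suc w = inj₁ λ v v<1+t → [ below v , (λ { refl → w , ft }) ]′ (m<1+n⇒m<n∨m≡n v<1+t)

leastZero : ∀ f t → f t ≡ 0 → Σ ℕ λ u → u ≤ t × LeastZero f u
leastZero f t ft with nonZeroBelow-or-leastZero f (suc t)
... | inj₁ below = contradiction (trans (sym ft) (proj₂ (below t ≤-refl))) λ ()
... | inj₂ (u , u<1+t , least) = u , ≤-pred u<1+t , least

initCode runCode universal : Code
initCode  = evalCode cFst cSnd (cPair cZero cZero)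
runCode   = cRec cId (stepCode ∘c cSnd ∘c cSnd) ∘c cPair (initCode ∘c cFst) cSnd
universal = at 1 ∘c runCode ∘c cPair cId (cMin (haltTestCode ∘c runCode))

run : ℕ → ℕ → ℕ → ℕ
run m n = fold (evalState m n haltK) step

eval-run : ∀ {O} m n t → Eval O runCode ⟨ ⟨ m , n ⟩ , t ⟩ (run m n t)
eval-run {O} m n t =
  eComp (eval-pair (eComp eval-fst (eval-evalCode eval-fst eval-snd (eval-pair eZero eZero))) eval-snd)
        (eval-rec (iterates t))
  where
  iterates : ∀ t → RecEval O cId (stepCode ∘c cSnd ∘c cSnd) (evalState m n haltK) t (run m n t)
  iterates zero    = rZero eId
  iterates (suc t) = rec-suc (iterates t)
    (eComp (eComp eval-snd eval-snd) (proj₂ (isTotal⇒Total stepCode tt (run m n t)) O))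

fold-halted : ∀ s {u t} → haltTest (fold s step u) ≡ 0 → u ≤ t → fold s step t ≡ fold s step u
fold-halted s {u} {t} halted u≤t = begin
  fold s step t                      ≡⟨ cong (fold s step) (m∸n+n≡m u≤t) ⟨
  fold s step (t ∸ u + u)            ≡⟨ fold-+ s step (t ∸ u) ⟩
  fold (fold s step u) step (t ∸ u)  ≡⟨ fold-fixed step (haltTest≡0⇒step-fixed _ halted) (t ∸ u) ⟩
  fold s step u                      ∎
  where open ≡-Reasoning

universal-halts : ∀ {O m n y} t → run m n t ≡ returnState y haltK → Eval O universal ⟨ m , n ⟩ y
universal-halts {O} {m} {n} {y} t ran
  with leastZero (λ v → haltTest (run m n v)) t (trans (cong haltTest ran) (haltTest-returnState y))
... | u , u≤t , halted , below =
  eComp (eComp (eval-pair eId (eMin (subst (Eval O _ _) halted (eval-haltTest∘run u)) running-before))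
               (eval-run m n u))
        (subst (λ s → Eval O (at 1) s y) (trans (sym ran) (fold-halted _ halted u≤t)) (eval-at 1))
  where
  eval-haltTest∘run : ∀ v → Eval O (haltTestCode ∘c runCode) (pair ⟨ m , n ⟩ v) (haltTest (run m n v))
  eval-haltTest∘run v = subst (λ i → Eval O (haltTestCode ∘c runCode) i (haltTest (run m n v))) (⟨,⟩≡pair _ v)
                              (eComp (eval-run m n v) (eval-haltTest _))
  running-before : ∀ v → v < u → Σ ℕ λ w → Eval O (haltTestCode ∘c runCode) (pair ⟨ m , n ⟩ v) (suc w)
  running-before v v<u = let (w , eq) = below v v<u in w , subst (Eval O _ _) eq (eval-haltTest∘run v)

universal-correct : ∀ {O m n y} → Φ[ m ]^ ∅ [ n ]≡ y → Eval O universal ⟨ m , n ⟩ y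
universal-correct {m = m} d = let (t , ran) = ⟶*⇒fold (simulate m refl d haltK) in universal-halts t ran

-- Oracle replacement and the recursion theorem

_computes_relativeTo_ : Code → Subset → Subset → Set
r computes Z relativeTo O = ∀ n → Eval O r n (if Z n then 1 else 0)

replaceOracle : Code → Code → Code
replaceOracle r cOracle     = r
replaceOracle r cZero       = cZero
replaceOracle r cSucc       = cSucc
replaceOracle r cId         = cId
replaceOracle r cFst        = cFst
replaceOracle r cSnd        = cSnd
replaceOracle r (cComp a b) = cComp (replaceOracle r a) (replaceOracle r b)
replaceOracle r (cPair a b) = cPair (replaceOracle r a) (replaceOracle r b)
replaceOracle r (cRec a b)  = cRec (replaceOracle r a) (replaceOracle r b)
replaceOracle r (cMin a)    = cMin (replaceOracle r a)

module _ {O O′ : Subset} {r : Code} (r-computes : r computes O relativeTo O′) where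
  mutual
    eval-replaceOracle : ∀ {c x y} → Eval O c x y → Eval O′ (replaceOracle r c) x y
    eval-replaceOracle eZero         = eZero
    eval-replaceOracle eSucc         = eSucc
    eval-replaceOracle eId           = eId
    eval-replaceOracle eFst          = eFst
    eval-replaceOracle eSnd          = eSnd
    eval-replaceOracle (eOracle {x}) = r-computes x
    eval-replaceOracle (eComp d₁ d₂) = eComp (eval-replaceOracle d₁) (eval-replaceOracle d₂)
    eval-replaceOracle (ePair d₁ d₂) = ePair (eval-replaceOracle d₁) (eval-replaceOracle d₂)
    eval-replaceOracle (eRec rd)     = eRec (recEval-replaceOracle rd)
    eval-replaceOracle (eMin d below) = eMin (eval-replaceOracle d) λ m m<n → nonzero-replaceOracle (below m m<n)

    recEval-replaceOracle : ∀ {f g x n y} → RecEval O f g x n y →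
      RecEval O′ (replaceOracle r f) (replaceOracle r g) x n y
    recEval-replaceOracle (rZero d)    = rZero (eval-replaceOracle d)
    recEval-replaceOracle (rSuc rd d) = rSuc (recEval-replaceOracle rd) (eval-replaceOracle d)

    nonzero-replaceOracle : ∀ {f x} → Σ ℕ (λ k → Eval O f x (suc k)) →
      Σ ℕ (λ k → Eval O′ (replaceOracle r f) x (suc k))
    nonzero-replaceOracle (k , d) = k , eval-replaceOracle d

⊕-even : ∀ X Y q → (X ⊕ Y) (q * 2) ≡ X q
⊕-even X Y zero    = refl
⊕-even X Y (suc q) = ⊕-even (λ k → X (suc k)) (λ k → Y (suc k)) q

⊕-odd : ∀ X Y q → (X ⊕ Y) (1 + q * 2) ≡ Y q
⊕-odd X Y zero    = refl
⊕-odd X Y (suc q) = ⊕-odd (λ k → X (suc k)) (λ k → Y (suc k)) q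

halfCode : Code
halfCode = divModCode 1

-- The oracle query is the branch that ifZero evaluates in any case.
joinCode : Code → Code
joinCode x = ifZero (cSnd ∘c halfCode) (cOracle ∘c cFst ∘c halfCode) (x ∘c cFst ∘c halfCode)

joinCode-computes : ∀ {O X x} → x computes X relativeTo O → joinCode x computes (X ⊕ O) relativeTo O
joinCode-computes {O} {X} {x} x-computes z =
  subst (λ m → Eval O (joinCode x) m (if (X ⊕ O) m then 1 else 0)) (sym (m≡m%n+[m/n]*n z 2))
        (go (z % 2) (z / 2) (m%n<n z 2))
  where
  half : ∀ r q → r < 2 → Eval O halfCode (r + q * 2) ⟨ q , 1 ∸ r ⟩
  half r q r<2 = subst₂ (λ a b → Eval O halfCode (r + q * 2) ⟨ a , 1 ∸ b ⟩)
                        ([r+qn]/n≡q q 2 r<2) ([r+qn]%n≡r q 2 r<2) (eval-divModCode 1 (r + q * 2))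
  go : ∀ r q → r < 2 → Eval O (joinCode x) (r + q * 2) (if (X ⊕ O) (r + q * 2) then 1 else 0)
  go 0 q r<2 rewrite ⊕-even X O q =
    ifZero-suc (eComp (half 0 q r<2) eval-snd) (_ , eComp (eComp (half 0 q r<2) eval-fst) eOracle)
               (eComp (eComp (half 0 q r<2) eval-fst) (x-computes q))
  go 1 q r<2 rewrite ⊕-odd X O q =
    ifZero-zero (eComp (half 1 q r<2) eval-snd) (eComp (eComp (half 1 q r<2) eval-fst) eOracle)
  go (suc (suc _)) q (s≤s (s≤s ()))

data Template : Set where
  hole : Template
  lit  : Code → Template
  tComp tPair tRec : Template → Template → Template
  tMin : Template → Template

fill : Template → Code → Code
fill hole        h = h
fill (lit c)     h = c
fill (tComp a b) h = cComp (fill a h) (fill b h)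
fill (tPair a b) h = cPair (fill a h) (fill b h)
fill (tRec a b)  h = cRec (fill a h) (fill b h)
fill (tMin a)    h = cMin (fill a h)

replaceOracleᵗ : Template → Code → Template
replaceOracleᵗ r cOracle     = r
replaceOracleᵗ r cZero       = lit cZero
replaceOracleᵗ r cSucc       = lit cSucc
replaceOracleᵗ r cId         = lit cId
replaceOracleᵗ r cFst        = lit cFst
replaceOracleᵗ r cSnd        = lit cSnd
replaceOracleᵗ r (cComp a b) = tComp (replaceOracleᵗ r a) (replaceOracleᵗ r b)
replaceOracleᵗ r (cPair a b) = tPair (replaceOracleᵗ r a) (replaceOracleᵗ r b)
replaceOracleᵗ r (cRec a b)  = tRec (replaceOracleᵗ r a) (replaceOracleᵗ r b)
replaceOracleᵗ r (cMin a)    = tMin (replaceOracleᵗ r a)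

fill-replaceOracleᵗ : ∀ r c h → fill (replaceOracleᵗ r c) h ≡ replaceOracle (fill r h) c
fill-replaceOracleᵗ r cOracle     h = refl
fill-replaceOracleᵗ r cZero       h = refl
fill-replaceOracleᵗ r cSucc       h = refl
fill-replaceOracleᵗ r cId         h = refl
fill-replaceOracleᵗ r cFst        h = refl
fill-replaceOracleᵗ r cSnd        h = refl
fill-replaceOracleᵗ r (cComp a b) h = cong₂ cComp (fill-replaceOracleᵗ r a h) (fill-replaceOracleᵗ r b h)
fill-replaceOracleᵗ r (cPair a b) h = cong₂ cPair (fill-replaceOracleᵗ r a h) (fill-replaceOracleᵗ r b h)
fill-replaceOracleᵗ r (cRec a b)  h = cong₂ cRec (fill-replaceOracleᵗ r a h) (fill-replaceOracleᵗ r b h)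
fill-replaceOracleᵗ r (cMin a)    h = cong cMin (fill-replaceOracleᵗ r a h)

index : Template → ℕ → ℕ
index hole        n = n
index (lit c)     n = encode c
index (tComp a b) n = node 6 (index a n) (index b n)
index (tPair a b) n = node 7 (index a n) (index b n)
index (tRec a b)  n = node 8 (index a n) (index b n)
index (tMin a)    n = node 9 (index a n) 0

decode-index : ∀ t n → decode (index t n) ≡ fill t (decode n)
decode-index hole        n = refl
decode-index (lit c)     n = decode-encode c
decode-index (tComp a b) n =
  trans (decode-node (index a n) (index b n)) (cong₂ cComp (decode-index a n) (decode-index b n))
decode-index (tPair a b) n =
  trans (decode-node (index a n) (index b n)) (cong₂ cPair (decode-index a n) (decode-index b n))
decode-index (tRec a b)  n =
  trans (decode-node (index a n) (index b n)) (cong₂ cRec (decode-index a n) (decode-index b n))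
decode-index (tMin a)    n = trans (decode-node (index a n) 0) (cong cMin (decode-index a n))

addCode : ℕ → Code
addCode zero    = cId
addCode (suc k) = cSucc ∘c addCode k

eval-addCode : ∀ {O} k x → Eval O (addCode k) x (k + x)
eval-addCode zero    x = eId
eval-addCode (suc k) x = eComp (eval-addCode k x) eSucc

times10Code : Code
times10Code = recOn cZero (addCode 10 ∘c cSnd)

eval-times10Code : ∀ {O} n → Eval O times10Code n (n * 10)
eval-times10Code = recOn-correct (_* 10) eZero (λ n → eComp eval-snd (eval-addCode 10 (n * 10)))

nodeCode : ℕ → Code → Code → Code
nodeCode t a b = addCode (suc t) ∘c times10Code ∘c cPair a b

eval-nodeCode : ∀ {O x a b} t {ca cb} → Eval O ca x a → Eval O cb x b →
  Eval O (nodeCode t ca cb) x (node t a b)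
eval-nodeCode {O} {x} {a} {b} t da db =
  eComp (eComp (eval-pair da db)
               (subst (λ p → Eval O times10Code ⟨ a , b ⟩ (p * 10)) (⟨,⟩≡pair a b) (eval-times10Code _)))
        (eval-addCode (suc t) _)

indexCode : Template → Code
indexCode hole        = cId
indexCode (lit c)     = const (encode c)
indexCode (tComp a b) = nodeCode 6 (indexCode a) (indexCode b)
indexCode (tPair a b) = nodeCode 7 (indexCode a) (indexCode b)
indexCode (tRec a b)  = nodeCode 8 (indexCode a) (indexCode b)
indexCode (tMin a)    = nodeCode 9 (indexCode a) cZero

eval-indexCode : ∀ {O} t n → Eval O (indexCode t) n (index t n)
eval-indexCode hole        n = eId
eval-indexCode (lit c)     n = eval-const (encode c)
eval-indexCode (tComp a b) n = eval-nodeCode 6 (eval-indexCode a n) (eval-indexCode b n)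
eval-indexCode (tPair a b) n = eval-nodeCode 7 (eval-indexCode a n) (eval-indexCode b n)
eval-indexCode (tRec a b)  n = eval-nodeCode 8 (eval-indexCode a n) (eval-indexCode b n)
eval-indexCode (tMin a)    n = eval-nodeCode 9 (eval-indexCode a n) eZero

-- By encode (const (suc u)) = node 6 (encode cSucc) (encode (const u)).
encodeConstCode : Code
encodeConstCode = recOn cZero (nodeCode 6 (const (encode cSucc)) cSnd)

eval-encodeConstCode : ∀ {O} u → Eval O encodeConstCode u (encode (const u))
eval-encodeConstCode =
  recOn-correct (λ u → encode (const u)) eZero (λ _ → eval-nodeCode 6 (eval-const 2) eval-snd)

-- The index of decode u ∘c const u: decode u run on its own index.
selfApplyCode : Code
selfApplyCode = nodeCode 6 cId encodeConstCode

selfApply : ℕ → ℕ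
selfApply u = node 6 u (encode (const u))

-- Kleene's recursion theorem.  Opaque, since encode diag is astronomically large and must
-- never be normalised.
opaque
  recursion-theorem : ∀ t → Σ ℕ λ j → Σ Code λ self → decode j ≡ fill t self × (∀ {O x} → Eval O self x j)
  recursion-theorem t = fixed-point (encode diag) (decode-encode diag)
    where
    diag : Code
    diag = indexCode t ∘c selfApplyCode
    fixed-point : ∀ v → decode v ≡ diag →
      Σ ℕ λ j → Σ Code λ self → decode j ≡ fill t self × (∀ {O x} → Eval O self x j)
    fixed-point v decode-v = index t (selfApply v) , diag ∘c const v , decode-j , eval-self
      where
      decode-j : decode (index t (selfApply v)) ≡ fill t (diag ∘c const v)
      decode-j = begin
        decode (index t (selfApply v))                  ≡⟨ decode-index t (selfApply v) ⟩
        fill t (decode (selfApply v))                   ≡⟨ cong (fill t) (decode-node v (encode (const v))) ⟩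
        fill t (decode v ∘c decode (encode (const v)))
          ≡⟨ cong (fill t) (cong₂ _∘c_ decode-v (decode-encode (const v))) ⟩
        fill t (diag ∘c const v)                        ∎
        where open ≡-Reasoning
      eval-self : ∀ {O x} → Eval O (diag ∘c const v) x (index t (selfApply v))
      eval-self = eComp (eval-const v)
        (eComp (eval-nodeCode 6 eId (eval-encodeConstCode v)) (eval-indexCode t (selfApply v)))

ifZeroᵗ : Template → Template → Template → Template
ifZeroᵗ t a b = tComp (tRec a (tComp b (lit cFst))) (tPair (lit cId) t)

-- fill (joinᵗ x) h reduces to joinCode (fill x h).
joinᵗ : Template → Template
joinᵗ x =
  ifZeroᵗ (lit (cSnd ∘c halfCode)) (lit (cOracle ∘c cFst ∘c halfCode)) (tComp x (lit (cFst ∘c halfCode)))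

-- The diagonal argument

-- Replacing the oracle by cZero lets the ∅-computation of f run under any oracle.
diagonalSetᵗ : ℕ → ℕ → Template
diagonalSetᵗ c φ =
  tComp (lit universal) (tPair (tComp (lit (replaceOracle cZero (decode c))) (tPair (lit (const φ)) hole)) (lit cId))

diagonalSet-computes : ∀ {f : ℕ → ℕ → ℕ} c φ {j : ℕ} {self : Code} →
  (∀ i j → Φ[ c ]^ ∅ [ pair i j ]≡ f i j) → (∀ {O x} → Eval O self x j) →
  ∀ {X Y} → Computes (f φ j) ∅ X → fill (diagonalSetᵗ c φ) self computes X relativeTo Y
diagonalSet-computes {f} c φ {j} {self} c-computes eval-self {X} {Y} X-computed q =
  eComp (eval-pair f-φ-j eId) (universal-correct {m = f φ j} (X-computed q))
  where
  f-φ-j : Eval Y (replaceOracle cZero (decode c) ∘c cPair (const φ) self) q (f φ j)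
  f-φ-j = eComp (eval-pair (eval-const φ) eval-self)
    (subst (λ i → Eval Y (replaceOracle cZero (decode c)) i (f φ j)) (sym (⟨,⟩≡pair φ j))
           (eval-replaceOracle {O = ∅} (λ _ → eZero) (c-computes φ j)))

-- Opaque for the same reason as recursion-theorem.
opaque
  diagonal-index : ∀ f → ComputableFun₂ f → ∀ φ ψ → Σ ℕ λ j →
    ∀ X Y → Computes (f φ j) ∅ X → ∀ {n y} → Φ[ ψ ]^ (X ⊕ Y) [ n ]≡ y → Φ[ j ]^ Y [ n ]≡ y
  diagonal-index f (c , c-computes) φ ψ
    with recursion-theorem (replaceOracleᵗ (joinᵗ (diagonalSetᵗ c φ)) (decode ψ))
  ... | j , self , decode-j , eval-self = j , λ X Y X-computed {n} {y} d →
    subst (λ e → Eval Y e n y) (sym (trans decode-j (fill-replaceOracleᵗ _ (decode ψ) self)))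
          (eval-replaceOracle (joinCode-computes (diagonalSet-computes c φ c-computes eval-self X-computed)) d)

if-1-0-injective : ∀ {a b : Bool} → (if a then 1 else 0) ≡ (if b then 1 else 0) → a ≡ b
if-1-0-injective {true}  {true}  _ = refl
if-1-0-injective {false} {false} _ = refl
if-1-0-injective {true}  {false} ()
if-1-0-injective {false} {true}  ()

computes-unique : ∀ e {O Z Z′} → Computes e O Z → Computes e O Z′ → Z ≗ Z′
computes-unique e Z-computed Z′-computed n = if-1-0-injective (eval-deterministic (Z-computed n) (Z′-computed n))

lemma3 : (P Q : Problem) (f : ℕ → ℕ → ℕ) → ComputableFun₂ f →
    (∀ i j → Σ Subset λ X → Computes (f i j) ∅ X × Inst P X × Defeats P Q i j X) →
    ¬ (P ≤W Q)
lemma3 P Q f f-computable defeat (φ , ψ , reduction)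
  with diagonal-index f f-computable φ ψ
... | j , j-simulates with defeat φ j
... | X , X-computed , X-instance , defeats with reduction X X-instance
... | Z , Z-computed , Z-instance , solve with defeats
... | inj₁ not-instance = not-instance (Z , Z-computed , Z-instance)
... | inj₂ (Ŷ , Z′ , Z′-computed , Ŷ-solves-Z′ , not-solution)
  with solve Ŷ (Sol-ext Q (computes-unique φ Z′-computed Z-computed) (λ _ → refl) Ŷ-solves-Z′)
... | W , W-computed , W-solves = not-solution (W , (λ n → j-simulates X Ŷ X-computed (W-computed n)) , W-solves)
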